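{- Let $H_3$ be a connected graph, let $w_1w_2$ be an edge lying on a cycle of $H_3$, and let $v$ be a vertex with $d_{H_3}(v)\ge 3$. Suppose $H_3$ contains two pendent paths at $v$: $v\,v_2\,u_{21}\,u_{22}\cdots u_{2t_2}$ and $v\,v_\ell\,u_{\ell 1}\,u_{\ell 2}\cdots u_{\ell t_\ell}$ with $t_2,t_\ell\ge 1$, which share only the vertex $v$, such that every vertex of each path other than $v$ and its last vertex has degree $2$ in $H_3$, and the last vertices $u_{2t_2}$ and $u_{\ell t_\ell}$ have degree $1$ in $H_3$. Let $H_4=H_3-\{vv_2,\,v_2u_{21},\,w_1w_2\}+\{v_2w_1,\,v_2w_2,\,u_{21}u_{\ell t_\ell}\}$. Then $M_i(H_4)<M_i(H_3)$ for $i=1,2$.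
   Context: All graphs are finite and simple. For a graph $G$ with vertex degrees $d(u)$, $M_1(G)=\sum_{u\in V(G)} d(u)^2$ and $M_2(G)=\sum_{uv\in E(G)} d(u)d(v)$. $H-F+F'$ denotes the graph obtained from $H$ by deleting the edge set $F$ and adding the edge set $F'$. -}

module Defs where

open import Data.Nat using (ℕ; zero; suc; _+_; _*_; _^_; _<ᵇ_)
open import Data.Bool using (Bool; true; false; if_then_else_; _∧_; _∨_; not; T)
open import Data.Fin using (Fin; toℕ; fromℕ; inject₁; _≟_) renaming (zero to fz; suc to fs)
open import Data.List using (List; []; _∷_; map; allFin)
open import Data.Nat.ListAction using (sum)
open import Data.Product using (_×_; _,_)
open import Relation.Nullary.Decidable using (⌊_⌋)
open import Relation.Binary.PropositionalEquality using (_≡_)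

Graph : ℕ → Set
Graph n = Fin n → Fin n → Bool

IsSimple : ∀ {n} → Graph n → Set
IsSimple {n} G = (∀ (x y : Fin n) → G x y ≡ G y x) × (∀ (x : Fin n) → G x x ≡ false)

deg : ∀ {n} → Graph n → Fin n → ℕ
deg {n} G u = sum (map (λ x → if G u x then 1 else 0) (allFin n))

M1 : ∀ {n} → Graph n → ℕ
M1 {n} G = sum (map (λ u → deg G u ^ 2) (allFin n))

M2 : ∀ {n} → Graph n → ℕ
M2 {n} G = sum (map (λ u → sum (map (λ x →
  if (toℕ u <ᵇ toℕ x) ∧ G u x then deg G u * deg G x else 0) (allFin n))) (allFin n))

data Reach {n} (G : Graph n) : Fin n → Fin n → Set where
  here : ∀ {x} → Reach G x x
  step : ∀ {x y z} → T (G x y) → Reach G y z → Reach G x z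

Connected : ∀ {n} → Graph n → Set
Connected {n} G = ∀ (x y : Fin n) → Reach G x y

-- The edge ab lies on a cycle: there is a cycle c0 c1 ... c_{k+2} c0 (k+3 ≥ 3 distinct
-- vertices) of G with c0 = a and c1 = b.
record EdgeOnCycle {n} (G : Graph n) (a b : Fin n) : Set where
  field
    len    : ℕ
    c      : Fin (3 + len) → Fin n
    inj    : ∀ i j → c i ≡ c j → i ≡ j
    adj    : ∀ (i : Fin (2 + len)) → T (G (c (inject₁ i)) (c (fs i)))
    close  : T (G (c (fromℕ (2 + len))) (c fz))
    first  : c fz ≡ a
    second : c (fs fz) ≡ b

-- A pendent path at v with t vertices after its second vertex:
-- p 0 = v, p 1 = v_j, p (i+1) = u_{j i} (1 ≤ i ≤ t); all distinct, consecutive ones adjacent,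
-- internal vertices p 1 .. p t have degree 2, last vertex p (t+1) has degree 1.
record PendentPath {n} (G : Graph n) (v : Fin n) (t : ℕ) (p : Fin (2 + t) → Fin n) : Set where
  field
    start    : p fz ≡ v
    inj      : ∀ i j → p i ≡ p j → i ≡ j
    adj      : ∀ (i : Fin (1 + t)) → T (G (p (inject₁ i)) (p (fs i)))
    internal : ∀ (i : Fin t) → deg G (p (fs (inject₁ i))) ≡ 2
    end      : deg G (p (fromℕ (1 + t))) ≡ 1

-- finite edge sets (unordered pairs given as ordered pairs)
EdgeSet : ℕ → Set
EdgeSet n = List (Fin n × Fin n)

inE : ∀ {n} → EdgeSet n → Fin n → Fin n → Bool
inE [] x y = false
inE ((a , b) ∷ F) x y = ((⌊ x ≟ a ⌋ ∧ ⌊ y ≟ b ⌋) ∨ (⌊ x ≟ b ⌋ ∧ ⌊ y ≟ a ⌋)) ∨ inE F x y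

edit : ∀ {n} → Graph n → EdgeSet n → EdgeSet n → Graph n
edit G F F' x y = (G x y ∧ not (inE F x y)) ∨ inE F' x y

-- Only v and the end vertex z = u_{ℓ t_ℓ} change degree: d(v) drops by one and d(z) rises from 1
-- to 2. For this the three removed and three added edges must be genuinely distinct, which holds
-- because the vertices of a pendent path other than v lie on no cycle (membership in a set where
-- every vertex has two neighbours would propagate to the degree-1 end), so v₂, u₂₁ ∉ {w₁, w₂}.
-- Then M₁ drops by 2d(v) − 4 > 0. For M₂ compare 2M₂ with the sum of d(u)d(x) over ordered adjacent
-- pairs: with the H₃-degrees kept, the edge replacement changes this sum by
-- 2(2a + 2b + e) − 2(2d + 2e + ab), where d, e, a, b are the degrees of v, u₂₁, w₁, w₂; moving the
-- degree unit from v to z then changes it by at most 2(2 + e) − 2·2, since v keeps its neighbour v_ℓ of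
-- degree 2 and z gets the neighbours u_{ℓ t_ℓ − 1} and u₂₁ of degrees 2 and e. The total change
-- −2(a − 2)(b − 2) − 4(d − 3) − 4 is negative.

module Submission where

open import Defs
open import Data.Nat using (ℕ; zero; suc; _+_; _*_; _^_; _≤_; _<_; _<ᵇ_; z≤n; s≤s)
open import Data.Nat.Properties
  using ( +-*-semiring; +-commutativeSemigroup; *-commutativeSemigroup
        ; +-identityʳ; *-identityʳ; +-assoc; +-comm; *-comm; *-distribʳ-+; *-distribˡ-+
        ; +-cancelʳ-≡; +-cancelʳ-≤; *-cancelˡ-<; +-mono-≤; +-monoˡ-≤; +-monoʳ-≤; *-monoʳ-≤
        ; ≤-trans; ≤-reflexive; ≤-antisym; ≤-pred; m≤m+n; m≤n+m; 1+n≰n; <-asym; ≮⇒≥; <ᵇ⇒<; <⇒<ᵇ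
        ; module ≤-Reasoning )
open import Data.Nat.Tactic.RingSolver using (solve-∀)
open import Data.Bool using (Bool; true; false; if_then_else_; _∧_; _∨_; not; T)
open import Data.Bool.Properties using (T-∨; ∧-comm; ∨-comm)
open import Data.Fin using (Fin; toℕ; fromℕ; inject₁) renaming (zero to fz; suc to fs)
open import Data.Fin.Properties using (_≟_; suc-injective; toℕ-injective)
open import Data.Fin.Induction using (>-weakInduction)
open import Data.List using (List; []; _∷_; map; allFin; tabulate; length)
import Data.Nat.ListAction as List
open import Data.List.Relation.Unary.All using (All; []; _∷_; lookupAny)
open import Data.List.Relation.Unary.All.Properties using (All¬⇒¬Any)
open import Data.List.Relation.Unary.AllPairs using (AllPairs; []; _∷_)
open import Data.List.Relation.Unary.Any as Any using (Any; here; there)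
open import Data.List.Relation.Unary.Unique.Propositional using (Unique)
open import Data.Product using (_×_; _,_; ∃; ∃₂; proj₁; proj₂)
open import Data.Sum using (_⊎_; inj₁; inj₂; map₂)
open import Data.Empty using (⊥-elim)
open import Function using (_∘_)
open import Function.Bundles using (module Equivalence)
open import Relation.Nullary using (¬_; yes; no)
open import Relation.Nullary.Decidable using (⌊_⌋)
open import Relation.Binary.PropositionalEquality
open import Algebra.Properties.Semiring.Sum +-*-semiring
  using (sum-syntax; ∑-distrib-+; ∑-comm; sum-cong-≗; sum-replicate-zero; *-distribˡ-sum)
open import Algebra.Properties.CommutativeSemigroup *-commutativeSemigroup
  using () renaming (x∙yz≈y∙xz to x*[y*z]≡y*[x*z]; xy∙z≈y∙xz to x*y*z≡y*[x*z])
open import Algebra.Properties.CommutativeSemigroup +-commutativeSemigroup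
  using () renaming (xy∙z≈xz∙y to x+y+z≡x+z+y)

⟦_⟧ : Bool → ℕ
⟦ b ⟧ = if b then 1 else 0

δ : ∀ {n} → Fin n → Fin n → ℕ
δ x y = ⟦ ⌊ x ≟ y ⌋ ⟧

δ-refl : ∀ {n} (x : Fin n) → δ x x ≡ 1
δ-refl x with x ≟ x
... | yes _ = refl
... | no x≢x = ⊥-elim (x≢x refl)

δ-≢ : ∀ {n} {x y : Fin n} → ¬ x ≡ y → δ x y ≡ 0
δ-≢ {x = x} {y} x≢y with x ≟ y
... | yes x≡y = ⊥-elim (x≢y x≡y)
... | no _ = refl

δ-suc : ∀ {n} (x y : Fin n) → δ (fs x) (fs y) ≡ δ x y
δ-suc x y with x ≟ y
... | yes _ = refl
... | no _ = refl

sum-map-tabulate : ∀ {m n} (f : Fin n → ℕ) (g : Fin m → Fin n) →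
  List.sum (map f (tabulate g)) ≡ ∑[ i < m ] f (g i)
sum-map-tabulate {zero} f g = refl
sum-map-tabulate {suc m} f g = cong (f (g fz) +_) (sum-map-tabulate f (g ∘ fs))

sum-map-allFin : ∀ {n} (f : Fin n → ℕ) → List.sum (map f (allFin n)) ≡ ∑[ i < n ] f i
sum-map-allFin f = sum-map-tabulate f (λ i → i)

∑-zero : ∀ n → ∑[ i < n ] 0 ≡ 0
∑-zero = sum-replicate-zero

∑-mono-≤ : ∀ {n} {f g : Fin n → ℕ} → (∀ i → f i ≤ g i) → ∑[ i < n ] f i ≤ ∑[ i < n ] g i
∑-mono-≤ {zero} f≤g = z≤n
∑-mono-≤ {suc n} f≤g = +-mono-≤ (f≤g fz) (∑-mono-≤ (f≤g ∘ fs))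

∑-δ : ∀ {n} (a : Fin n) (f : Fin n → ℕ) → ∑[ i < n ] (δ i a * f i) ≡ f a
∑-δ {suc n} fz f = begin
  1 * f fz + ∑[ i < n ] (0 * f (fs i)) ≡⟨ cong (f fz + 0 +_) (∑-zero n) ⟩
  f fz + 0 + 0                          ≡⟨ trans (+-identityʳ _) (+-identityʳ _) ⟩
  f fz                                  ∎
  where open ≡-Reasoning
∑-δ {suc n} (fs a) f = begin
  0 * f fz + ∑[ i < n ] (δ (fs i) (fs a) * f (fs i))
    ≡⟨ sum-cong-≗ (λ i → cong (_* f (fs i)) (δ-suc i a)) ⟩
  ∑[ i < n ] (δ i a * f (fs i))                      ≡⟨ ∑-δ a (f ∘ fs) ⟩
  f (fs a)                                           ∎
  where open ≡-Reasoning

∑-δ-single : ∀ {n} (a : Fin n) → ∑[ i < n ] δ i a ≡ 1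
∑-δ-single a = trans (sum-cong-≗ (λ i → sym (*-identityʳ (δ i a)))) (∑-δ a (λ _ → 1))

term≤∑ : ∀ {n} (f : Fin n → ℕ) (a : Fin n) → f a ≤ ∑[ i < n ] f i
term≤∑ f fz = m≤m+n _ _
term≤∑ f (fs a) = ≤-trans (term≤∑ (f ∘ fs) a) (m≤n+m _ (f fz))

⟦⟧-T : ∀ {b} → T b → ⟦ b ⟧ ≡ 1
⟦⟧-T {true} _ = refl

deg≡∑ : ∀ {n} (G : Graph n) u → deg G u ≡ ∑[ x < n ] ⟦ G u x ⟧
deg≡∑ G u = sum-map-allFin (λ x → ⟦ G u x ⟧)

occurrences : ∀ {n} → List (Fin n) → Fin n → ℕ
occurrences [] x = 0
occurrences (a ∷ as) x = δ x a + occurrences as x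

∑-occurrences : ∀ {n} (xs : List (Fin n)) → ∑[ x < n ] occurrences xs x ≡ length xs
∑-occurrences {n} [] = ∑-zero n
∑-occurrences (a ∷ as) =
  trans (∑-distrib-+ (λ x → δ x a) (occurrences as)) (cong₂ _+_ (∑-δ-single a) (∑-occurrences as))

occurrences-absent : ∀ {n} {x : Fin n} {as} → All (λ a → ¬ x ≡ a) as → occurrences as x ≡ 0
occurrences-absent [] = refl
occurrences-absent (x≢a ∷ x∉as) = cong₂ _+_ (δ-≢ x≢a) (occurrences-absent x∉as)

occurrences≤adjacency : ∀ {n} (G : Graph n) u {xs} → Unique xs → All (λ a → T (G u a)) xs →
  ∀ x → occurrences xs x ≤ ⟦ G u x ⟧
occurrences≤adjacency G u [] [] x = z≤n
occurrences≤adjacency G u {a ∷ as} (a∉as ∷ uniq) (adj ∷ adjs) x with x ≟ a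
... | yes refl = ≤-reflexive (trans (cong suc (occurrences-absent a∉as)) (sym (⟦⟧-T adj)))
... | no _ = occurrences≤adjacency G u uniq adjs x

distinct-neighbours≤deg : ∀ {n} (G : Graph n) u {xs} → Unique xs → All (λ a → T (G u a)) xs →
  length xs ≤ deg G u
distinct-neighbours≤deg {n} G u {xs} uniq adjs = begin
  length xs                      ≡⟨ ∑-occurrences xs ⟨
  ∑[ x < n ] occurrences xs x    ≤⟨ ∑-mono-≤ (occurrences≤adjacency G u uniq adjs) ⟩
  ∑[ x < n ] ⟦ G u x ⟧           ≡⟨ deg≡∑ G u ⟨
  deg G u                        ∎
  where open ≤-Reasoning

two-neighbours⇒2≤deg : ∀ {n} (G : Graph n) {u a b} → ¬ a ≡ b → T (G u a) → T (G u b) → 2 ≤ deg G u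
two-neighbours⇒2≤deg G {u} a≢b ua ub =
  distinct-neighbours≤deg G u ((a≢b ∷ []) ∷ [] ∷ []) (ua ∷ ub ∷ [])

deg≡1⇒neighbour-unique : ∀ {n} (G : Graph n) {u a c} → deg G u ≡ 1 → T (G u a) → T (G u c) → c ≡ a
deg≡1⇒neighbour-unique G {a = a} {c} d≡1 ua uc with c ≟ a
... | yes c≡a = c≡a
... | no c≢a = ⊥-elim (1+n≰n (subst (2 ≤_) d≡1 (two-neighbours⇒2≤deg G (c≢a ∘ sym) ua uc)))

deg≡2⇒neighbour∈ : ∀ {n} (G : Graph n) {u a b c} → deg G u ≡ 2 → ¬ a ≡ b →
  T (G u a) → T (G u b) → T (G u c) → c ≡ a ⊎ c ≡ b
deg≡2⇒neighbour∈ G {u} {a} {b} {c} d≡2 a≢b ua ub uc with c ≟ a | c ≟ b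
... | yes c≡a | _ = inj₁ c≡a
... | no _ | yes c≡b = inj₂ c≡b
... | no c≢a | no c≢b = ⊥-elim (1+n≰n (subst (3 ≤_) d≡2
      (distinct-neighbours≤deg G u ((a≢b ∷ (c≢a ∘ sym) ∷ []) ∷ ((c≢b ∘ sym) ∷ []) ∷ [] ∷ [])
                                (ua ∷ ub ∷ uc ∷ []))))

adjacent-sym : ∀ {n} {G : Graph n} → IsSimple G → ∀ {x y} → T (G x y) → T (G y x)
adjacent-sym (sym-G , _) {x} {y} = subst T (sym-G x y)

-- Pendent paths avoid cycles

MinDegree₂ : ∀ {n} → Graph n → (Fin n → Set) → Set
MinDegree₂ G S = ∀ {x} → S x → ∃₂ λ a b → ¬ a ≡ b × (T (G x a) × S a) × (T (G x b) × S b)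

OnCycle : ∀ {n} {G : Graph n} {a b} → EdgeOnCycle G a b → Fin n → Set
OnCycle C x = ∃ λ i → EdgeOnCycle.c C i ≡ x

data LastView : ∀ {m} → Fin (suc m) → Set where
  last   : ∀ {m} → LastView (fromℕ m)
  inject : ∀ {m} (k : Fin m) → LastView (inject₁ k)

lastView : ∀ {m} (i : Fin (suc m)) → LastView i
lastView {zero} fz = last
lastView {suc m} fz = inject fz
lastView {suc m} (fs i) with lastView i
... | last = last
... | inject k = inject (fs k)

inject₁²≢suc² : ∀ {m} (i : Fin m) → ¬ inject₁ (inject₁ i) ≡ fs (fs i)
inject₁²≢suc² fz ()
inject₁²≢suc² (fs i) eq = inject₁²≢suc² i (suc-injective eq)

cycle-minDegree₂ : ∀ {n} {G : Graph n} {a b} → IsSimple G → (C : EdgeOnCycle G a b) →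
  MinDegree₂ G (OnCycle C)
cycle-minDegree₂ {G = G} simple C (i , refl) =
  let j , k , j≢k , ij , ik = around i
  in c j , c k , j≢k ∘ inj j k , (ij , j , refl) , (ik , k , refl)
  where
  open EdgeOnCycle C
  around : ∀ i → ∃₂ λ j k → ¬ j ≡ k × T (G (c i) (c j)) × T (G (c i) (c k))
  around fz = fs fz , fromℕ (2 + len) , (λ ()) , adj fz , adjacent-sym simple close
  around (fs i) with lastView i
  ... | last = inject₁ (fromℕ (1 + len)) , fz , (λ ())
               , adjacent-sym simple (adj (fromℕ (1 + len))) , close
  ... | inject k = inject₁ (inject₁ k) , fs (fs k) , inject₁²≢suc² k
                 , adjacent-sym simple (adj (inject₁ k)) , adj (fs k)

pendentPath-avoids : ∀ {n} {G : Graph n} {v t p} {S : Fin n → Set} → IsSimple G →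
  PendentPath G v t p → MinDegree₂ G S → ∀ (i : Fin (1 + t)) → ¬ S (p (fs i))
pendentPath-avoids {G = G} {t = t} {p} {S} simple path core =
  >-weakInduction (λ i → ¬ S (p (fs i))) end∉S backwards
  where
  open PendentPath path
  end∉S : ¬ S (p (fromℕ (1 + t)))
  end∉S s with core s
  ... | _ , _ , a≢b , (ua , _) , (ub , _) =
    1+n≰n (subst (2 ≤_) end (two-neighbours⇒2≤deg G a≢b ua ub))
  neighbour∈ : ∀ i {c} → T (G (p (fs (inject₁ i))) c) →
    c ≡ p (inject₁ (inject₁ i)) ⊎ c ≡ p (fs (fs i))
  neighbour∈ i = deg≡2⇒neighbour∈ G (internal i) (inject₁²≢suc² i ∘ inj _ _)
                   (adjacent-sym simple (adj (inject₁ i))) (adj (fs i))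
  backwards : ∀ (i : Fin t) → ¬ S (p (fs (fs i))) → ¬ S (p (fs (inject₁ i)))
  backwards i next∉S s with core s
  ... | a , b , a≢b , (ua , sa) , (ub , sb) with neighbour∈ i ua | neighbour∈ i ub
  ... | inj₂ refl | _ = next∉S sa
  ... | _ | inj₂ refl = next∉S sb
  ... | inj₁ refl | inj₁ refl = a≢b refl

⟦⟧-∧ : ∀ p q → ⟦ p ⟧ * ⟦ q ⟧ ≡ ⟦ p ∧ q ⟧
⟦⟧-∧ false q = refl
⟦⟧-∧ true false = refl
⟦⟧-∧ true true = refl

⟦⟧-∨ : ∀ {p q} → ¬ (T p × T q) → ⟦ p ⟧ + ⟦ q ⟧ ≡ ⟦ p ∨ q ⟧
⟦⟧-∨ {false} {q} _ = refl
⟦⟧-∨ {true} {false} _ = refl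
⟦⟧-∨ {true} {true} both = ⊥-elim (both (_ , _))

SameEdge : ∀ {n} → Fin n × Fin n → Fin n × Fin n → Set
SameEdge (u , x) (a , b) = (u ≡ a × x ≡ b) ⊎ (u ≡ b × x ≡ a)

sameEdge-flip : ∀ {n} {u x : Fin n} {e} → SameEdge (u , x) e → SameEdge (x , u) e
sameEdge-flip (inj₁ (p , q)) = inj₂ (q , p)
sameEdge-flip (inj₂ (p , q)) = inj₁ (q , p)

sameEdge-sym : ∀ {n} {e e′ : Fin n × Fin n} → SameEdge e e′ → SameEdge e′ e
sameEdge-sym (inj₁ (p , q)) = inj₁ (sym p , sym q)
sameEdge-sym (inj₂ (p , q)) = inj₂ (sym q , sym p)

sameEdge-trans : ∀ {n} {e e′ e″ : Fin n × Fin n} → SameEdge e e′ → SameEdge e′ e″ → SameEdge e e″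
sameEdge-trans (inj₁ (refl , refl)) s = s
sameEdge-trans (inj₂ (refl , refl)) s = sameEdge-flip s

_∈ₑ_ : ∀ {n} → Fin n × Fin n → EdgeSet n → Set
e ∈ₑ F = Any (SameEdge e) F

NonLoop : ∀ {n} → Fin n × Fin n → Set
NonLoop (a , b) = ¬ a ≡ b

SimpleEdges : ∀ {n} → EdgeSet n → Set
SimpleEdges F = All NonLoop F × AllPairs (λ e e′ → ¬ SameEdge e e′) F

edgeTest : ∀ {n} → Fin n → Fin n → Fin n × Fin n → Bool
edgeTest u x (a , b) = (⌊ u ≟ a ⌋ ∧ ⌊ x ≟ b ⌋) ∨ (⌊ u ≟ b ⌋ ∧ ⌊ x ≟ a ⌋)

T-≟∧≟ : ∀ {n} {u a x b : Fin n} → T (⌊ u ≟ a ⌋ ∧ ⌊ x ≟ b ⌋) → u ≡ a × x ≡ b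
T-≟∧≟ {u = u} {a} {x} {b} t with u ≟ a | x ≟ b
T-≟∧≟ t | yes p | yes q = p , q
T-≟∧≟ () | yes _ | no _
T-≟∧≟ () | no _ | _

≟∧≟-T : ∀ {n} {u a x b : Fin n} → u ≡ a → x ≡ b → T (⌊ u ≟ a ⌋ ∧ ⌊ x ≟ b ⌋)
≟∧≟-T {u = u} {x = x} refl refl with u ≟ u | x ≟ x
... | yes _ | yes _ = _
... | yes _ | no x≢x = x≢x refl
... | no u≢u | _ = u≢u refl

T-edgeTest⇒sameEdge : ∀ {n} {u x : Fin n} e → T (edgeTest u x e) → SameEdge (u , x) e
T-edgeTest⇒sameEdge {u = u} {x} (a , b) t with Equivalence.to (T-∨ {⌊ u ≟ a ⌋ ∧ ⌊ x ≟ b ⌋}) t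
... | inj₁ t₁ = inj₁ (T-≟∧≟ {u = u} {a} {x} {b} t₁)
... | inj₂ t₂ = inj₂ (T-≟∧≟ {u = u} {b} {x} {a} t₂)

sameEdge⇒T-edgeTest : ∀ {n} {u x : Fin n} e → SameEdge (u , x) e → T (edgeTest u x e)
sameEdge⇒T-edgeTest {u = u} {x} (a , b) (inj₁ (p , q)) =
  Equivalence.from (T-∨ {⌊ u ≟ a ⌋ ∧ ⌊ x ≟ b ⌋}) (inj₁ (≟∧≟-T p q))
sameEdge⇒T-edgeTest {u = u} {x} (a , b) (inj₂ (p , q)) =
  Equivalence.from (T-∨ {⌊ u ≟ a ⌋ ∧ ⌊ x ≟ b ⌋}) (inj₂ (≟∧≟-T p q))

T-inE⇒∈ₑ : ∀ {n} (F : EdgeSet n) {u x} → T (inE F u x) → (u , x) ∈ₑ F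
T-inE⇒∈ₑ (e ∷ F) {u} {x} t with Equivalence.to (T-∨ {edgeTest u x e}) t
... | inj₁ t₁ = here (T-edgeTest⇒sameEdge e t₁)
... | inj₂ t₂ = there (T-inE⇒∈ₑ F t₂)

∈ₑ⇒T-inE : ∀ {n} {F : EdgeSet n} {u x} → (u , x) ∈ₑ F → T (inE F u x)
∈ₑ⇒T-inE {F = e ∷ _} {u} {x} (here s) =
  Equivalence.from (T-∨ {edgeTest u x e}) (inj₁ (sameEdge⇒T-edgeTest e s))
∈ₑ⇒T-inE {F = e ∷ _} {u} {x} (there m) =
  Equivalence.from (T-∨ {edgeTest u x e}) (inj₂ (∈ₑ⇒T-inE m))

-- Unlike ⟦ inE F u x ⟧, the multiplicity has a hypothesis-free weighted double sum (∑₂-multiplicity);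
-- the two agree on simple edge lists.
multiplicity : ∀ {n} → EdgeSet n → Fin n → Fin n → ℕ
multiplicity [] u x = 0
multiplicity ((a , b) ∷ F) u x = δ u a * δ x b + δ u b * δ x a + multiplicity F u x

multiplicity≡⟦inE⟧ : ∀ {n} {F : EdgeSet n} → SimpleEdges F → ∀ u x →
  multiplicity F u x ≡ ⟦ inE F u x ⟧
multiplicity≡⟦inE⟧ {F = []} _ u x = refl
multiplicity≡⟦inE⟧ {F = (a , b) ∷ F} (a≢b ∷ loopless , ab∉F ∷ distinct) u x = begin
  δ u a * δ x b + δ u b * δ x a + multiplicity F u x
    ≡⟨ cong₂ _+_ (cong₂ _+_ (⟦⟧-∧ ⌊ u ≟ a ⌋ ⌊ x ≟ b ⌋) (⟦⟧-∧ ⌊ u ≟ b ⌋ ⌊ x ≟ a ⌋))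
                 (multiplicity≡⟦inE⟧ (loopless , distinct) u x) ⟩
  ⟦ ⌊ u ≟ a ⌋ ∧ ⌊ x ≟ b ⌋ ⟧ + ⟦ ⌊ u ≟ b ⌋ ∧ ⌊ x ≟ a ⌋ ⟧ + ⟦ inE F u x ⟧
    ≡⟨ cong (_+ ⟦ inE F u x ⟧) (⟦⟧-∨ not-both-orientations) ⟩
  ⟦ edgeTest u x (a , b) ⟧ + ⟦ inE F u x ⟧
    ≡⟨ ⟦⟧-∨ not-also-in-F ⟩
  ⟦ inE ((a , b) ∷ F) u x ⟧ ∎
  where
  open ≡-Reasoning
  not-both-orientations : ¬ (T (⌊ u ≟ a ⌋ ∧ ⌊ x ≟ b ⌋) × T (⌊ u ≟ b ⌋ ∧ ⌊ x ≟ a ⌋))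
  not-both-orientations (t₁ , t₂) =
    a≢b (trans (sym (proj₁ (T-≟∧≟ {u = u} {a} {x} {b} t₁)))
               (proj₁ (T-≟∧≟ {u = u} {b} {x} {a} t₂)))
  not-also-in-F : ¬ (T (edgeTest u x (a , b)) × T (inE F u x))
  not-also-in-F (t , t′) =
    All¬⇒¬Any ab∉F
      (Any.map (sameEdge-trans (sameEdge-sym (T-edgeTest⇒sameEdge (a , b) t))) (T-inE⇒∈ₑ F t′))

∑₂ : ∀ {n} → (Fin n → Fin n → ℕ) → ℕ
∑₂ {n} w = ∑[ u < n ] ∑[ x < n ] w u x

∑₂-cong : ∀ {n} {w w′ : Fin n → Fin n → ℕ} → (∀ u x → w u x ≡ w′ u x) → ∑₂ w ≡ ∑₂ w′
∑₂-cong w≡w′ = sum-cong-≗ (λ u → sum-cong-≗ (w≡w′ u))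

∑₂-distrib-+ : ∀ {n} (w w′ : Fin n → Fin n → ℕ) → ∑₂ (λ u x → w u x + w′ u x) ≡ ∑₂ w + ∑₂ w′
∑₂-distrib-+ {n} w w′ = trans (sum-cong-≗ (λ u → ∑-distrib-+ (w u) (w′ u)))
  (∑-distrib-+ (λ u → ∑[ x < n ] w u x) (λ u → ∑[ x < n ] w′ u x))

∑₂-δδ : ∀ {n} (a b : Fin n) (w : Fin n → Fin n → ℕ) → ∑₂ (λ u x → δ u a * δ x b * w u x) ≡ w a b
∑₂-δδ {n} a b w = begin
  ∑[ u < n ] ∑[ x < n ] (δ u a * δ x b * w u x)
    ≡⟨ ∑₂-cong (λ u x → x*y*z≡y*[x*z] (δ u a) (δ x b) (w u x)) ⟩
  ∑[ u < n ] ∑[ x < n ] (δ x b * (δ u a * w u x))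
    ≡⟨ sum-cong-≗ (λ u → ∑-δ b (λ x → δ u a * w u x)) ⟩
  ∑[ u < n ] (δ u a * w u b)
    ≡⟨ ∑-δ a (λ u → w u b) ⟩
  w a b ∎
  where open ≡-Reasoning

adjacentSum : ∀ {n} → Graph n → (Fin n → Fin n → ℕ) → ℕ
adjacentSum G w = ∑₂ (λ u x → ⟦ G u x ⟧ * w u x)

edgeSum : ∀ {n} → EdgeSet n → (Fin n → Fin n → ℕ) → ℕ
edgeSum [] w = 0
edgeSum ((a , b) ∷ F) w = w a b + w b a + edgeSum F w

∑₂-multiplicity : ∀ {n} (F : EdgeSet n) (w : Fin n → Fin n → ℕ) →
  ∑₂ (λ u x → multiplicity F u x * w u x) ≡ edgeSum F w
∑₂-multiplicity {n} [] w = begin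
  ∑[ u < n ] ∑[ x < n ] 0 ≡⟨ sum-cong-≗ {n} (λ _ → ∑-zero n) ⟩
  ∑[ u < n ] 0            ≡⟨ ∑-zero n ⟩
  0                       ∎
  where open ≡-Reasoning
∑₂-multiplicity ((a , b) ∷ F) w = begin
  ∑₂ (λ u x → (δ u a * δ x b + δ u b * δ x a + multiplicity F u x) * w u x)
    ≡⟨ ∑₂-cong (λ u x → distrib₃ (δ u a * δ x b) (δ u b * δ x a) (multiplicity F u x) (w u x)) ⟩
  ∑₂ (λ u x → δ u a * δ x b * w u x + δ u b * δ x a * w u x + multiplicity F u x * w u x)
    ≡⟨ trans (∑₂-distrib-+ (λ u x → δ u a * δ x b * w u x + δ u b * δ x a * w u x) _)
             (cong (_+ _) (∑₂-distrib-+ (λ u x → δ u a * δ x b * w u x) _)) ⟩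
  ∑₂ (λ u x → δ u a * δ x b * w u x) + ∑₂ (λ u x → δ u b * δ x a * w u x)
    + ∑₂ (λ u x → multiplicity F u x * w u x)
    ≡⟨ cong₂ _+_ (cong₂ _+_ (∑₂-δδ a b w) (∑₂-δδ b a w)) (∑₂-multiplicity F w) ⟩
  w a b + w b a + edgeSum F w ∎
  where
  open ≡-Reasoning
  distrib₃ : ∀ p q r w → (p + q + r) * w ≡ p * w + q * w + r * w
  distrib₃ p q r w = trans (*-distribʳ-+ w (p + q) r) (cong (_+ r * w) (*-distribʳ-+ w p q))

deg≡adjacentSum : ∀ {n} (G : Graph n) u → deg G u ≡ adjacentSum G (λ u′ _ → δ u′ u)
deg≡adjacentSum {n} G u = begin
  deg G u
    ≡⟨ deg≡∑ G u ⟩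
  ∑[ x < n ] ⟦ G u x ⟧
    ≡⟨ ∑-δ u (λ u′ → ∑[ x < n ] ⟦ G u′ x ⟧) ⟨
  ∑[ u′ < n ] (δ u′ u * ∑[ x < n ] ⟦ G u′ x ⟧)
    ≡⟨ sum-cong-≗ (λ u′ → *-distribˡ-sum (δ u′ u) (⟦_⟧ ∘ G u′)) ⟩
  ∑[ u′ < n ] ∑[ x < n ] (δ u′ u * ⟦ G u′ x ⟧)
    ≡⟨ ∑₂-cong (λ u′ x → *-comm (δ u′ u) ⟦ G u′ x ⟧) ⟩
  adjacentSum G (λ u′ _ → δ u′ u) ∎
  where open ≡-Reasoning

-- Replacing edges

⟦⟧-edit : ∀ g f f′ → (T f → T g) → (T g → T f′ → T f) →
  ⟦ (g ∧ not f) ∨ f′ ⟧ + ⟦ f ⟧ ≡ ⟦ g ⟧ + ⟦ f′ ⟧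
⟦⟧-edit false false false _ _ = refl
⟦⟧-edit false false true _ _ = refl
⟦⟧-edit false true f′ f⇒g _ = ⊥-elim (f⇒g _)
⟦⟧-edit true false false _ _ = refl
⟦⟧-edit true false true _ g∧f′⇒f = ⊥-elim (g∧f′⇒f _ _)
⟦⟧-edit true true false _ _ = refl
⟦⟧-edit true true true _ _ = refl

IsEdge : ∀ {n} → Graph n → Fin n × Fin n → Set
IsEdge G (a , b) = T (G a b)

record EdgeReplacement {n} (G : Graph n) (F F′ : EdgeSet n) : Set where
  field
    removed-simple  : SimpleEdges F
    added-simple    : SimpleEdges F′
    removed-present : All (IsEdge G) F
    added-absent    : All (λ e → IsEdge G e → e ∈ₑ F) F′

sameEdge-adjacent : ∀ {n} {G : Graph n} → IsSimple G → ∀ {u x e} →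
  SameEdge (u , x) e → IsEdge G e → T (G u x)
sameEdge-adjacent simple (inj₁ (refl , refl)) ab = ab
sameEdge-adjacent simple (inj₂ (refl , refl)) ab = adjacent-sym simple ab

module _ {n} {G : Graph n} {F F′ : EdgeSet n} (simple : IsSimple G) (R : EdgeReplacement G F F′) where
  open EdgeReplacement R

  removed⇒adjacent : ∀ {u x} → (u , x) ∈ₑ F → T (G u x)
  removed⇒adjacent ux∈F with lookupAny removed-present ux∈F
  ... | e-present , ux~e = sameEdge-adjacent simple ux~e e-present

  adjacent∧added⇒removed : ∀ {u x} → T (G u x) → (u , x) ∈ₑ F′ → (u , x) ∈ₑ F
  adjacent∧added⇒removed ux ux∈F′ with lookupAny added-absent ux∈F′
  ... | e-absent , ux~e =
    Any.map (sameEdge-trans ux~e) (e-absent (sameEdge-adjacent simple (sameEdge-sym ux~e) ux))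

  edit-indicator : ∀ u x →
    ⟦ edit G F F′ u x ⟧ + multiplicity F u x ≡ ⟦ G u x ⟧ + multiplicity F′ u x
  edit-indicator u x
    rewrite multiplicity≡⟦inE⟧ removed-simple u x | multiplicity≡⟦inE⟧ added-simple u x =
    ⟦⟧-edit (G u x) (inE F u x) (inE F′ u x)
      (removed⇒adjacent ∘ T-inE⇒∈ₑ F)
      (λ ux → ∈ₑ⇒T-inE ∘ adjacent∧added⇒removed ux ∘ T-inE⇒∈ₑ F′)

  adjacentSum-edit : ∀ w →
    adjacentSum (edit G F F′) w + edgeSum F w ≡ adjacentSum G w + edgeSum F′ w
  adjacentSum-edit w = begin
    adjacentSum G′ w + edgeSum F w
      ≡⟨ cong (adjacentSum G′ w +_) (∑₂-multiplicity F w) ⟨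
    adjacentSum G′ w + ∑₂ (λ u x → multiplicity F u x * w u x)
      ≡⟨ ∑₂-distrib-+ (λ u x → ⟦ G′ u x ⟧ * w u x) _ ⟨
    ∑₂ (λ u x → ⟦ G′ u x ⟧ * w u x + multiplicity F u x * w u x)
      ≡⟨ ∑₂-cong (λ u x → trans (sym (*-distribʳ-+ (w u x) ⟦ G′ u x ⟧ _))
                        (trans (cong (_* w u x) (edit-indicator u x))
                               (*-distribʳ-+ (w u x) ⟦ G u x ⟧ _))) ⟩
    ∑₂ (λ u x → ⟦ G u x ⟧ * w u x + multiplicity F′ u x * w u x)
      ≡⟨ ∑₂-distrib-+ (λ u x → ⟦ G u x ⟧ * w u x) _ ⟩
    adjacentSum G w + ∑₂ (λ u x → multiplicity F′ u x * w u x)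
      ≡⟨ cong (adjacentSum G w +_) (∑₂-multiplicity F′ w) ⟩
    adjacentSum G w + edgeSum F′ w ∎
    where
    open ≡-Reasoning
    G′ = edit G F F′

  deg-edit : ∀ u →
    deg (edit G F F′) u + edgeSum F (λ a _ → δ a u) ≡ deg G u + edgeSum F′ (λ a _ → δ a u)
  deg-edit u = begin
    deg (edit G F F′) u + edgeSum F w
      ≡⟨ cong (_+ edgeSum F w) (deg≡adjacentSum (edit G F F′) u) ⟩
    adjacentSum (edit G F F′) w + edgeSum F w
      ≡⟨ adjacentSum-edit w ⟩
    adjacentSum G w + edgeSum F′ w
      ≡⟨ cong (_+ edgeSum F′ w) (deg≡adjacentSum G u) ⟨
    deg G u + edgeSum F′ w ∎
    where
    open ≡-Reasoning
    w = λ a (_ : Fin n) → δ a u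

inE-sym : ∀ {n} (F : EdgeSet n) u x → inE F u x ≡ inE F x u
inE-sym [] u x = refl
inE-sym ((a , b) ∷ F) u x =
  cong₂ _∨_ (trans (∨-comm (⌊ u ≟ a ⌋ ∧ ⌊ x ≟ b ⌋) _)
                   (cong₂ _∨_ (∧-comm ⌊ u ≟ b ⌋ _) (∧-comm ⌊ u ≟ a ⌋ _)))
            (inE-sym F u x)

¬T⇒≡false : ∀ {b} → ¬ T b → b ≡ false
¬T⇒≡false {false} _ = refl
¬T⇒≡false {true} ¬t = ⊥-elim (¬t _)

nonLoops-∌loop : ∀ {n} {F : EdgeSet n} → All NonLoop F → ∀ x → ¬ (x , x) ∈ₑ F
nonLoops-∌loop F-nonLoops x xx∈F with lookupAny F-nonLoops xx∈F
... | a≢b , inj₁ (x≡a , x≡b) = a≢b (trans (sym x≡a) x≡b)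
... | a≢b , inj₂ (x≡b , x≡a) = a≢b (trans (sym x≡a) x≡b)

edit-simple : ∀ {n} {G : Graph n} (F F′ : EdgeSet n) → IsSimple G → All NonLoop F′ →
  IsSimple (edit G F F′)
edit-simple {G = G} F F′ (sym-G , loop-G) F′-nonLoops = symmetric , loopless
  where
  symmetric : ∀ x y → edit G F F′ x y ≡ edit G F F′ y x
  symmetric x y rewrite sym-G x y | inE-sym F x y | inE-sym F′ x y = refl
  loopless : ∀ x → edit G F F′ x x ≡ false
  loopless x rewrite loop-G x = ¬T⇒≡false (nonLoops-∌loop F′-nonLoops x ∘ T-inE⇒∈ₑ F′)

edit-adjacent : ∀ {n} (G : Graph n) F F′ {u x} → T (edit G F F′ u x) → T (G u x) ⊎ (u , x) ∈ₑ F′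
edit-adjacent G F F′ {u} {x} = map₂ (T-inE⇒∈ₑ F′) ∘ T-edit⇒ (G u x) (inE F u x) (inE F′ u x)
  where
  T-edit⇒ : ∀ g f f′ → T ((g ∧ not f) ∨ f′) → T g ⊎ T f′
  T-edit⇒ true f f′ _ = inj₁ _
  T-edit⇒ false f true _ = inj₂ _
  T-edit⇒ false f false ()

edit-retains : ∀ {n} (G : Graph n) F F′ {u x} → T (G u x) → ¬ (u , x) ∈ₑ F → T (edit G F F′ u x)
edit-retains G F F′ {u} {x} ux ux∉F =
  retain (G u x) (inE F u x) (inE F′ u x) ux (ux∉F ∘ T-inE⇒∈ₑ F)
  where
  retain : ∀ g f f′ → T g → ¬ T f → T ((g ∧ not f) ∨ f′)
  retain true false f′ _ _ = _
  retain true true f′ _ ¬f = ⊥-elim (¬f _)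

M1≡∑ : ∀ {n} (G : Graph n) → M1 G ≡ ∑[ u < n ] (deg G u ^ 2)
M1≡∑ G = sum-map-allFin (λ u → deg G u ^ 2)

upperTerm : ∀ {n} → Graph n → (Fin n → Fin n → ℕ) → Fin n → Fin n → ℕ
upperTerm G w u x = if (toℕ u <ᵇ toℕ x) ∧ G u x then w u x else 0

M2≡∑₂upperTerm : ∀ {n} (G : Graph n) → M2 G ≡ ∑₂ (upperTerm G (λ u x → deg G u * deg G x))
M2≡∑₂upperTerm {n} G =
  trans (sum-map-allFin (λ u → List.sum (map (upperTerm G w u) (allFin n))))
        (sum-cong-≗ (λ u → sum-map-allFin (upperTerm G w u)))
  where w = λ u x → deg G u * deg G x

⟦⟧*-if : ∀ b m → ⟦ b ⟧ * m ≡ (if b then m else 0)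
⟦⟧*-if false m = refl
⟦⟧*-if true m = +-identityʳ m

<ᵇ≡false⇒≮ : ∀ {i j} → (i <ᵇ j) ≡ false → ¬ i < j
<ᵇ≡false⇒≮ i≮ᵇj i<j = subst T i≮ᵇj (<⇒<ᵇ i<j)

adjacency-split : ∀ {n} {G : Graph n} → IsSimple G → ∀ {w} → (∀ u x → w u x ≡ w x u) →
  ∀ u x → ⟦ G u x ⟧ * w u x ≡ upperTerm G w u x + upperTerm G w x u
adjacency-split {G = G} (sym-G , loop-G) {w} w-sym u x
  with toℕ u <ᵇ toℕ x in u<x | toℕ x <ᵇ toℕ u in x<u
... | true | true = ⊥-elim (<-asym (<ᵇ⇒< (toℕ u) (toℕ x) (subst T (sym u<x) _))
                                    (<ᵇ⇒< (toℕ x) (toℕ u) (subst T (sym x<u) _)))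
... | true | false = trans (⟦⟧*-if (G u x) (w u x)) (sym (+-identityʳ _))
... | false | true rewrite sym-G x u | w-sym x u = ⟦⟧*-if (G u x) (w u x)
... | false | false
  with toℕ-injective {i = u} {j = x} (≤-antisym (≮⇒≥ (<ᵇ≡false⇒≮ x<u)) (≮⇒≥ (<ᵇ≡false⇒≮ u<x)))
...   | refl rewrite loop-G u = refl

adjacentSum≡2*upper : ∀ {n} {G : Graph n} → IsSimple G → ∀ {w} → (∀ u x → w u x ≡ w x u) →
  adjacentSum G w ≡ 2 * ∑₂ (upperTerm G w)
adjacentSum≡2*upper {n} {G} simple {w} w-sym = begin
  adjacentSum G w
    ≡⟨ ∑₂-cong (adjacency-split simple w-sym) ⟩
  ∑₂ (λ u x → upperTerm G w u x + upperTerm G w x u)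
    ≡⟨ ∑₂-distrib-+ (upperTerm G w) _ ⟩
  ∑₂ (upperTerm G w) + ∑₂ (λ u x → upperTerm G w x u)
    ≡⟨ cong (∑₂ (upperTerm G w) +_) (∑-comm (λ u x → upperTerm G w x u)) ⟩
  ∑₂ (upperTerm G w) + ∑₂ (upperTerm G w)
    ≡⟨ cong (∑₂ (upperTerm G w) +_) (+-identityʳ _) ⟨
  2 * ∑₂ (upperTerm G w) ∎
  where open ≡-Reasoning

2*M2≡adjacentSum : ∀ {n} (G : Graph n) → IsSimple G →
  2 * M2 G ≡ adjacentSum G (λ u x → deg G u * deg G x)
2*M2≡adjacentSum G simple = trans (cong (2 *_) (M2≡∑₂upperTerm G))
  (sym (adjacentSum≡2*upper simple (λ u x → *-comm (deg G u) (deg G x))))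

-- Moving one unit of degree

record UnitShift {n} (f g : Fin n → ℕ) (v z : Fin n) : Set where
  field
    source≢target : ¬ v ≡ z
    at-source     : g v ≡ suc (f v)
    at-target     : f z ≡ suc (g z)
    elsewhere     : ∀ {u} → ¬ u ≡ v → ¬ u ≡ z → f u ≡ g u

data Position {n} (v z : Fin n) : Fin n → Set where
  source : Position v z v
  target : Position v z z
  other  : ∀ {u} → ¬ u ≡ v → ¬ u ≡ z → Position v z u

position : ∀ {n} (v z u : Fin n) → Position v z u
position v z u with u ≟ v | u ≟ z
... | yes refl | _ = source
... | no _ | yes refl = target
... | no u≢v | no u≢z = other u≢v u≢z

δ-balance⇒unitShift : ∀ {n} {f g : Fin n → ℕ} {v z} → ¬ v ≡ z → (∀ u → f u + δ v u ≡ g u + δ z u) →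
  UnitShift f g v z
δ-balance⇒unitShift {f = f} {g} {v} {z} v≢z balance = record
  { source≢target = v≢z
  ; at-source     = sym (begin
      suc (f v)      ≡⟨ +-comm 1 (f v) ⟩
      f v + 1        ≡⟨ cong (f v +_) (δ-refl v) ⟨
      f v + δ v v    ≡⟨ balance v ⟩
      g v + δ z v    ≡⟨ cong (g v +_) (δ-≢ (v≢z ∘ sym)) ⟩
      g v + 0        ≡⟨ +-identityʳ (g v) ⟩
      g v            ∎)
  ; at-target     = begin
      f z            ≡⟨ +-identityʳ (f z) ⟨
      f z + 0        ≡⟨ cong (f z +_) (δ-≢ v≢z) ⟨
      f z + δ v z    ≡⟨ balance z ⟩
      g z + δ z z    ≡⟨ cong (g z +_) (δ-refl z) ⟩
      g z + 1        ≡⟨ +-comm (g z) 1 ⟩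
      suc (g z)      ∎
  ; elsewhere     = λ {u} u≢v u≢z → +-cancelʳ-≡ 0 (f u) (g u)
      (trans (cong (f u +_) (sym (δ-≢ (u≢v ∘ sym))))
             (trans (balance u) (cong (g u +_) (δ-≢ (u≢z ∘ sym)))))
  }
  where open ≡-Reasoning

∑-square-shift : ∀ {n} {f g : Fin n → ℕ} {v z} → UnitShift f g v z →
  ∑[ u < n ] (f u ^ 2) + (2 * f v + 1) ≡ ∑[ u < n ] (g u ^ 2) + (2 * g z + 1)
∑-square-shift {n} {f} {g} {v} {z} shift = begin
  ∑[ u < n ] (f u ^ 2) + (2 * f v + 1)
    ≡⟨ cong (_ +_) (∑-δ v (λ u → 2 * f u + 1)) ⟨
  ∑[ u < n ] (f u ^ 2) + ∑[ u < n ] (δ u v * (2 * f u + 1))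
    ≡⟨ ∑-distrib-+ (λ u → f u ^ 2) _ ⟨
  ∑[ u < n ] (f u ^ 2 + δ u v * (2 * f u + 1))
    ≡⟨ sum-cong-≗ pointwise ⟩
  ∑[ u < n ] (g u ^ 2 + δ u z * (2 * g u + 1))
    ≡⟨ ∑-distrib-+ (λ u → g u ^ 2) _ ⟩
  ∑[ u < n ] (g u ^ 2) + ∑[ u < n ] (δ u z * (2 * g u + 1))
    ≡⟨ cong (_ +_) (∑-δ z (λ u → 2 * g u + 1)) ⟩
  ∑[ u < n ] (g u ^ 2) + (2 * g z + 1) ∎
  where
  open ≡-Reasoning
  open UnitShift shift
  -- a * (a * 1) is a ^ 2 unfolded: the ring solver does not recognise ℕ's _^_.
  square-suc : ∀ a → a * (a * 1) + 1 * (2 * a + 1) ≡ (1 + a) * ((1 + a) * 1) + 0 * (2 * (1 + a) + 1)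
  square-suc = solve-∀
  pointwise : ∀ u → f u ^ 2 + δ u v * (2 * f u + 1) ≡ g u ^ 2 + δ u z * (2 * g u + 1)
  pointwise u with position v z u
  ... | source rewrite δ-refl v | δ-≢ source≢target | at-source = square-suc (f v)
  ... | target rewrite δ-refl z | δ-≢ (source≢target ∘ sym) | at-target = sym (square-suc (g z))
  ... | other u≢v u≢z rewrite δ-≢ u≢v | δ-≢ u≢z | elsewhere u≢v u≢z = refl

rowSum : ∀ {n} → Graph n → Fin n → (Fin n → ℕ) → ℕ
rowSum {n} G v g = ∑[ x < n ] (⟦ G v x ⟧ * g x)

neighbour≤rowSum : ∀ {n} (G : Graph n) {v q} (g : Fin n → ℕ) → T (G v q) → g q ≤ rowSum G v g
neighbour≤rowSum {n} G {v} {q} g vq = begin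
  g q                    ≡⟨ +-identityʳ (g q) ⟨
  1 * g q                ≡⟨ cong (_* g q) (⟦⟧-T vq) ⟨
  ⟦ G v q ⟧ * g q        ≤⟨ term≤∑ (λ x → ⟦ G v x ⟧ * g x) q ⟩
  rowSum G v g           ∎
  where open ≤-Reasoning

rowSum≤two-neighbours : ∀ {n} (G : Graph n) {z a b} (g : Fin n → ℕ) →
  (∀ {x} → T (G z x) → x ≡ a ⊎ x ≡ b) → rowSum G z g ≤ g a + g b
rowSum≤two-neighbours {n} G {z} {a} {b} g neighbours = begin
  rowSum G z g                                        ≤⟨ ∑-mono-≤ pointwise ⟩
  ∑[ x < n ] (δ x a * g x + δ x b * g x)              ≡⟨ ∑-distrib-+ (λ x → δ x a * g x) _ ⟩
  ∑[ x < n ] (δ x a * g x) + ∑[ x < n ] (δ x b * g x) ≡⟨ cong₂ _+_ (∑-δ a g) (∑-δ b g) ⟩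
  g a + g b                                           ∎
  where
  open ≤-Reasoning
  pointwise : ∀ x → ⟦ G z x ⟧ * g x ≤ δ x a * g x + δ x b * g x
  pointwise x with G z x in zx
  ... | false = z≤n
  ... | true with neighbours (subst T (sym zx) _)
  ...   | inj₁ refl rewrite δ-refl a = m≤m+n _ _
  ...   | inj₂ refl rewrite δ-refl b = m≤n+m _ (δ b a * g b)

adjacentSum-distrib-+ : ∀ {n} (G : Graph n) (w w′ : Fin n → Fin n → ℕ) →
  adjacentSum G (λ u x → w u x + w′ u x) ≡ adjacentSum G w + adjacentSum G w′
adjacentSum-distrib-+ G w w′ =
  trans (∑₂-cong (λ u x → *-distribˡ-+ ⟦ G u x ⟧ (w u x) (w′ u x)))
        (∑₂-distrib-+ (λ u x → ⟦ G u x ⟧ * w u x) _)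

adjacentSum-δ-row : ∀ {n} (G : Graph n) c g → adjacentSum G (λ u x → δ u c * g x) ≡ rowSum G c g
adjacentSum-δ-row {n} G c g = begin
  ∑[ u < n ] ∑[ x < n ] (⟦ G u x ⟧ * (δ u c * g x))
    ≡⟨ ∑₂-cong (λ u x → x*[y*z]≡y*[x*z] ⟦ G u x ⟧ (δ u c) (g x)) ⟩
  ∑[ u < n ] ∑[ x < n ] (δ u c * (⟦ G u x ⟧ * g x))
    ≡⟨ sum-cong-≗ (λ u → *-distribˡ-sum (δ u c) (λ x → ⟦ G u x ⟧ * g x)) ⟨
  ∑[ u < n ] (δ u c * rowSum G u g)
    ≡⟨ ∑-δ c (λ u → rowSum G u g) ⟩
  rowSum G c g ∎
  where open ≡-Reasoning

adjacentSum-δ-column : ∀ {n} {G : Graph n} → IsSimple G → ∀ c g →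
  adjacentSum G (λ u x → δ x c * g u) ≡ rowSum G c g
adjacentSum-δ-column {n} {G} (sym-G , _) c g = begin
  ∑[ u < n ] ∑[ x < n ] (⟦ G u x ⟧ * (δ x c * g u))
    ≡⟨ ∑₂-cong (λ u x → x*[y*z]≡y*[x*z] ⟦ G u x ⟧ (δ x c) (g u)) ⟩
  ∑[ u < n ] ∑[ x < n ] (δ x c * (⟦ G u x ⟧ * g u))
    ≡⟨ sum-cong-≗ (λ u → ∑-δ c (λ x → ⟦ G u x ⟧ * g u)) ⟩
  ∑[ u < n ] (⟦ G u c ⟧ * g u)
    ≡⟨ sum-cong-≗ (λ u → cong (λ b → ⟦ b ⟧ * g u) (sym-G u c)) ⟩
  rowSum G c g ∎
  where open ≡-Reasoning

-- On an edge at most one endpoint lies in {v, z} (G is loopless and v, z are nonadjacent), so there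
-- f u * f x and g u * g x differ exactly by the correction terms.
adjacentSum-shift : ∀ {n} {G : Graph n} {f g : Fin n → ℕ} {v z} → IsSimple G → ¬ T (G v z) →
  UnitShift f g v z →
  adjacentSum G (λ u x → f u * f x) + 2 * rowSum G v g ≡
    adjacentSum G (λ u x → g u * g x) + 2 * rowSum G z g
adjacentSum-shift {n} {G} {f} {g} {v} {z} simple@(sym-G , loop-G) ¬vz shift = begin
  adjacentSum G (λ u x → f u * f x) + 2 * rowSum G v g
    ≡⟨ cong (_ +_) (correction≡2*rowSum v) ⟨
  adjacentSum G (λ u x → f u * f x) + adjacentSum G (correction v)
    ≡⟨ adjacentSum-distrib-+ G (λ u x → f u * f x) (correction v) ⟨
  adjacentSum G (λ u x → f u * f x + correction v u x)
    ≡⟨ ∑₂-cong pointwise ⟩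
  adjacentSum G (λ u x → g u * g x + correction z u x)
    ≡⟨ adjacentSum-distrib-+ G (λ u x → g u * g x) (correction z) ⟩
  adjacentSum G (λ u x → g u * g x) + adjacentSum G (correction z)
    ≡⟨ cong (_ +_) (correction≡2*rowSum z) ⟩
  adjacentSum G (λ u x → g u * g x) + 2 * rowSum G z g ∎
  where
  open ≡-Reasoning
  open UnitShift shift
  correction : Fin n → Fin n → Fin n → ℕ
  correction c u x = δ u c * g x + δ x c * g u
  correction≡2*rowSum : ∀ c → adjacentSum G (correction c) ≡ 2 * rowSum G c g
  correction≡2*rowSum c = begin
    adjacentSum G (correction c)
      ≡⟨ adjacentSum-distrib-+ G (λ u x → δ u c * g x) (λ u x → δ x c * g u) ⟩
    adjacentSum G (λ u x → δ u c * g x) + adjacentSum G (λ u x → δ x c * g u)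
      ≡⟨ cong₂ _+_ (adjacentSum-δ-row G c g)
                   (trans (adjacentSum-δ-column simple c g) (sym (+-identityʳ _))) ⟩
    2 * rowSum G c g ∎
  from-source : ∀ a b → a * b + (1 * b + 0 * (1 + a)) ≡ (1 + a) * b + (0 * b + 0 * (1 + a))
  from-source = solve-∀
  into-target : ∀ a b → (1 + a) * b + (0 * b + 0 * a) ≡ a * b + (1 * b + 0 * a)
  into-target = solve-∀
  from-source′ : ∀ a b → b * a + (0 * (1 + a) + 1 * b) ≡ b * (1 + a) + (0 * (1 + a) + 0 * b)
  from-source′ = solve-∀
  into-target′ : ∀ a b → b * (1 + a) + (0 * a + 0 * b) ≡ b * a + (0 * a + 1 * b)
  into-target′ = solve-∀
  on-edge : ∀ u x → T (G u x) → f u * f x + correction v u x ≡ g u * g x + correction z u x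
  on-edge u x ux with position v z u | position v z x
  ... | source | source = ⊥-elim (subst T (loop-G v) ux)
  ... | source | target = ⊥-elim (¬vz ux)
  ... | target | source = ⊥-elim (¬vz (adjacent-sym simple ux))
  ... | target | target = ⊥-elim (subst T (loop-G z) ux)
  ... | source | other x≢v x≢z
    rewrite δ-refl v | δ-≢ x≢v | δ-≢ source≢target | δ-≢ x≢z | elsewhere x≢v x≢z | at-source =
    from-source (f v) (g x)
  ... | target | other x≢v x≢z
    rewrite δ-refl z | δ-≢ x≢v | δ-≢ (source≢target ∘ sym) | δ-≢ x≢z | elsewhere x≢v x≢z | at-target =
    into-target (g z) (g x)
  ... | other u≢v u≢z | source
    rewrite δ-refl v | δ-≢ u≢v | δ-≢ source≢target | δ-≢ u≢z | elsewhere u≢v u≢z | at-source =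
    from-source′ (f v) (g u)
  ... | other u≢v u≢z | target
    rewrite δ-refl z | δ-≢ u≢v | δ-≢ (source≢target ∘ sym) | δ-≢ u≢z | elsewhere u≢v u≢z | at-target =
    into-target′ (g z) (g u)
  ... | other u≢v u≢z | other x≢v x≢z
    rewrite δ-≢ u≢v | δ-≢ u≢z | δ-≢ x≢v | δ-≢ x≢z | elsewhere u≢v u≢z | elsewhere x≢v x≢z = refl
  pointwise : ∀ u x →
    ⟦ G u x ⟧ * (f u * f x + correction v u x) ≡ ⟦ G u x ⟧ * (g u * g x + correction z u x)
  pointwise u x with G u x in ux
  ... | false = refl
  ... | true = cong (1 *_) (on-edge u x (subst T (sym ux) _))

M1-arithmetic : ∀ {m′ m} d → m′ + (2 * d + 1) ≡ m + 3 → 2 ≤ d → m′ < m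
M1-arithmetic {m′} {m} _ eq (s≤s (s≤s (z≤n {d}))) = +-cancelʳ-≤ 3 (suc m′) m (begin
  suc m′ + 3                    ≤⟨ m≤m+n (suc m′ + 3) (1 + 2 * d) ⟩
  suc m′ + 3 + (1 + 2 * d)      ≡⟨ regroup m′ d ⟩
  m′ + (2 * (2 + d) + 1)        ≡⟨ eq ⟩
  m + 3                         ∎)
  where
  open ≤-Reasoning
  regroup : ∀ m′ d → 1 + m′ + 3 + (1 + 2 * d) ≡ m′ + (2 * (2 + d) + 1)
  regroup = solve-∀

-- After d ↦ 3 + d, a ↦ 2 + a, b ↦ 2 + b the decrease 2(a − 2)(b − 2) + 4(d − 3) + 4 of 2M₂ reads
-- 2ab + 4d + 4; one unit gives strictness and 3 + 4d + 2ab is slack.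
M2-arithmetic : ∀ {A′ A D r s} d t e a b o →
  A′ + 2 * r ≡ D + 2 * s →
  D + (d * t + t * d + (t * e + e * t + (a * b + b * a + 0))) ≡
    A + (t * a + a * t + (t * b + b * t + (e * o + o * e + 0))) →
  t ≡ 2 → o ≡ 1 → 2 ≤ r → s ≤ 2 + e → 3 ≤ d → 2 ≤ a → 2 ≤ b → A′ < A
M2-arithmetic {A′} {A} {D} {r} {s} _ .2 e _ _ .1 shift edit refl refl 2≤r s≤2+e
  (s≤s (s≤s (s≤s (z≤n {d})))) (s≤s (s≤s (z≤n {a}))) (s≤s (s≤s (z≤n {b}))) =
  +-cancelʳ-≤ B (suc A′) A (begin
  suc A′ + B            ≤⟨ m≤m+n (suc A′ + B) (3 + 4 * d + 2 * (a * b)) ⟩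
  suc A′ + B + (3 + 4 * d + 2 * (a * b))
                        ≡⟨ regroup A′ d e a b ⟩
  A′ + 2 * 2 + X        ≤⟨ +-monoˡ-≤ X (+-monoʳ-≤ A′ (*-monoʳ-≤ 2 2≤r)) ⟩
  A′ + 2 * r + X        ≡⟨ cong (_+ X) shift ⟩
  D + 2 * s + X         ≡⟨ x+y+z≡x+z+y D (2 * s) X ⟩
  D + X + 2 * s         ≡⟨ cong (_+ 2 * s) edit ⟩
  A + X′ + 2 * s        ≤⟨ +-monoʳ-≤ (A + X′) (*-monoʳ-≤ 2 s≤2+e) ⟩
  A + X′ + 2 * (2 + e)  ≡⟨ +-assoc A X′ _ ⟩
  A + B                 ∎)
  where
  open ≤-Reasoning
  X  = (3 + d) * 2 + 2 * (3 + d) + (2 * e + e * 2 + ((2 + a) * (2 + b) + (2 + b) * (2 + a) + 0))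
  X′ = 2 * (2 + a) + (2 + a) * 2 + (2 * (2 + b) + (2 + b) * 2 + (e * 1 + 1 * e + 0))
  B  = X′ + 2 * (2 + e)
  regroup : ∀ A′ d e a b →
    1 + A′ + (2 * (2 + a) + (2 + a) * 2 + (2 * (2 + b) + (2 + b) * 2 + (e * 1 + 1 * e + 0))
              + 2 * (2 + e))
      + (3 + 4 * d + 2 * (a * b))
    ≡ A′ + 2 * 2 + ((3 + d) * 2 + 2 * (3 + d)
                    + (2 * e + e * 2 + ((2 + a) * (2 + b) + (2 + b) * (2 + a) + 0)))
  regroup = solve-∀

distinctEdges : ∀ {n} {a b c d : Fin n} → (¬ a ≡ c ⊎ ¬ b ≡ d) → (¬ a ≡ d ⊎ ¬ b ≡ c) →
  ¬ SameEdge (a , b) (c , d)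
distinctEdges (inj₁ a≢c) _ (inj₁ (a≡c , _)) = a≢c a≡c
distinctEdges (inj₂ b≢d) _ (inj₁ (_ , b≡d)) = b≢d b≡d
distinctEdges _ (inj₁ a≢d) (inj₂ (a≡d , _)) = a≢d a≡d
distinctEdges _ (inj₂ b≢c) (inj₂ (_ , b≡c)) = b≢c b≡c

module Configuration {n} (G : Graph n) (simple : IsSimple G) (w1 w2 v : Fin n) (w1w2 : T (G w1 w2))
  (C : EdgeOnCycle G w1 w2) (3≤dv : 3 ≤ deg G v) (s2 sl : ℕ)
  (P : Fin (2 + suc s2) → Fin n) (Q : Fin (2 + suc sl) → Fin n)
  (pathP : PendentPath G v (suc s2) P) (pathQ : PendentPath G v (suc sl) Q)
  (disjoint : ∀ i j → P i ≡ Q j → (i ≡ fz × j ≡ fz)) where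

  -- In the paper's notation u = u₂₁, q = v_ℓ, z = u_{ℓ t_ℓ} and y is its neighbour; H is H₄.
  module PP = PendentPath pathP
  module PQ = PendentPath pathQ

  v₂ u q y z : Fin n
  v₂ = P (fs fz)
  u = P (fs (fs fz))
  q = Q (fs fz)
  y = Q (inject₁ (fromℕ (1 + sl)))
  z = Q (fromℕ (2 + sl))

  F F′ : EdgeSet n
  F = (v , v₂) ∷ (v₂ , u) ∷ (w1 , w2) ∷ []
  F′ = (v₂ , w1) ∷ (v₂ , w2) ∷ (u , z) ∷ []

  H : Graph n
  H = edit G F F′

  P≢P : ∀ {i j} → ¬ i ≡ j → ¬ P i ≡ P j
  P≢P i≢j = i≢j ∘ PP.inj _ _

  v≢Q : ∀ {j} → ¬ fz ≡ j → ¬ v ≡ Q j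
  v≢Q fz≢j v≡Qj = fz≢j (PQ.inj _ _ (trans PQ.start v≡Qj))

  P≢Q : ∀ {i j} → ¬ i ≡ fz → ¬ P i ≡ Q j
  P≢Q i≢fz = i≢fz ∘ proj₁ ∘ disjoint _ _

  offCycle : ∀ {t p} → PendentPath G v t p → ∀ i → ¬ OnCycle C (p (fs i))
  offCycle path = pendentPath-avoids simple path (cycle-minDegree₂ simple C)

  w1-onCycle : OnCycle C w1
  w1-onCycle = fz , EdgeOnCycle.first C

  w2-onCycle : OnCycle C w2
  w2-onCycle = fs fz , EdgeOnCycle.second C

  ≢onCycle : ∀ {x w} → ¬ OnCycle C x → OnCycle C w → ¬ x ≡ w
  ≢onCycle x-off w-on refl = x-off w-on

  v≢v₂ : ¬ v ≡ v₂
  v≢v₂ = subst (λ x → ¬ x ≡ v₂) PP.start (P≢P λ ())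
  v≢u : ¬ v ≡ u
  v≢u = subst (λ x → ¬ x ≡ u) PP.start (P≢P λ ())
  v₂≢u : ¬ v₂ ≡ u
  v₂≢u = P≢P λ ()
  v≢y : ¬ v ≡ y
  v≢y = v≢Q λ ()
  v≢z : ¬ v ≡ z
  v≢z = v≢Q λ ()
  v₂≢q : ¬ v₂ ≡ q
  v₂≢q = P≢Q λ ()
  v₂≢z : ¬ v₂ ≡ z
  v₂≢z = P≢Q λ ()
  u≢y : ¬ u ≡ y
  u≢y = P≢Q λ ()
  u≢z : ¬ u ≡ z
  u≢z = P≢Q λ ()
  v₂≢w1 : ¬ v₂ ≡ w1
  v₂≢w1 = ≢onCycle (offCycle pathP fz) w1-onCycle
  v₂≢w2 : ¬ v₂ ≡ w2
  v₂≢w2 = ≢onCycle (offCycle pathP fz) w2-onCycle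
  u≢w1 : ¬ u ≡ w1
  u≢w1 = ≢onCycle (offCycle pathP (fs fz)) w1-onCycle
  u≢w2 : ¬ u ≡ w2
  u≢w2 = ≢onCycle (offCycle pathP (fs fz)) w2-onCycle
  q≢w1 : ¬ q ≡ w1
  q≢w1 = ≢onCycle (offCycle pathQ fz) w1-onCycle
  q≢w2 : ¬ q ≡ w2
  q≢w2 = ≢onCycle (offCycle pathQ fz) w2-onCycle
  z≢w1 : ¬ z ≡ w1
  z≢w1 = ≢onCycle (offCycle pathQ (fromℕ (1 + sl))) w1-onCycle
  z≢w2 : ¬ z ≡ w2
  z≢w2 = ≢onCycle (offCycle pathQ (fromℕ (1 + sl))) w2-onCycle
  w1≢w2 : ¬ w1 ≡ w2
  w1≢w2 refl = subst T (proj₂ simple w1) w1w2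

  vv₂ : T (G v v₂)
  vv₂ = subst (λ x → T (G x v₂)) PP.start (PP.adj fz)
  v₂u : T (G v₂ u)
  v₂u = PP.adj (fs fz)
  vq : T (G v q)
  vq = subst (λ x → T (G x q)) PQ.start (PQ.adj fz)
  yz : T (G y z)
  yz = PQ.adj (fromℕ (1 + sl))

  deg-v₂ : deg G v₂ ≡ 2
  deg-v₂ = PP.internal fz
  deg-q : deg G q ≡ 2
  deg-q = PQ.internal fz
  deg-y : deg G y ≡ 2
  deg-y = PQ.internal (fromℕ sl)
  deg-z : deg G z ≡ 1
  deg-z = PQ.end

  2≤deg-onCycle : ∀ {w} → OnCycle C w → 2 ≤ deg G w
  2≤deg-onCycle w-on with cycle-minDegree₂ simple C w-on
  ... | _ , _ , a≢b , (wa , _) , (wb , _) = two-neighbours⇒2≤deg G a≢b wa wb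

  neighbour-of-v₂ : ∀ {x} → T (G v₂ x) → x ≡ v ⊎ x ≡ u
  neighbour-of-v₂ = deg≡2⇒neighbour∈ G deg-v₂ v≢u (adjacent-sym simple vv₂) v₂u

  neighbour-of-z : ∀ {x} → T (G z x) → x ≡ y
  neighbour-of-z = deg≡1⇒neighbour-unique G deg-z (adjacent-sym simple yz)

  replacement : EdgeReplacement G F F′
  replacement = record
    { removed-simple  = (v≢v₂ ∷ v₂≢u ∷ w1≢w2 ∷ [])
                      , ( (distinctEdges (inj₁ v≢v₂) (inj₁ v≢u)
                           ∷ distinctEdges (inj₂ v₂≢w2) (inj₂ v₂≢w1) ∷ [])
                        ∷ (distinctEdges (inj₁ v₂≢w1) (inj₁ v₂≢w2) ∷ [])
                        ∷ [] ∷ [])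
    ; added-simple    = (v₂≢w1 ∷ v₂≢w2 ∷ u≢z ∷ [])
                      , ( (distinctEdges (inj₂ w1≢w2) (inj₁ v₂≢w2)
                           ∷ distinctEdges (inj₁ v₂≢u) (inj₁ v₂≢z) ∷ [])
                        ∷ (distinctEdges (inj₁ v₂≢u) (inj₁ v₂≢z) ∷ [])
                        ∷ [] ∷ [])
    ; removed-present = vv₂ ∷ v₂u ∷ w1w2 ∷ []
    ; added-absent    = v₂-edge u≢w1 ∷ v₂-edge u≢w2
                        ∷ (⊥-elim ∘ u≢y ∘ neighbour-of-z ∘ adjacent-sym simple) ∷ []
    }
    where
    v₂-edge : ∀ {w} → ¬ u ≡ w → T (G v₂ w) → (v₂ , w) ∈ₑ F
    v₂-edge u≢w v₂w with neighbour-of-v₂ v₂w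
    ... | inj₁ w≡v = here (inj₂ (refl , w≡v))
    ... | inj₂ w≡u = ⊥-elim (u≢w (sym w≡u))

  degree-shift : UnitShift (deg H) (deg G) v z
  degree-shift = δ-balance⇒unitShift v≢z λ x →
    cancel (deg H x) (deg G x) (δ v x) (δ v₂ x) (δ u x) (δ w1 x) (δ w2 x) (δ z x)
      (deg-edit simple replacement x)
    where
    cancel : ∀ h g a b c d e o →
      h + (a + b + (b + c + (d + e + 0))) ≡ g + (b + d + (b + e + (c + o + 0))) → h + a ≡ g + o
    cancel h g a b c d e o eq = +-cancelʳ-≡ (b + b + c + d + e) (h + a) (g + o)
      (trans (regroupˡ h a b c d e) (trans eq (regroupʳ g b c d e o)))
      where
      regroupˡ : ∀ h a b c d e → h + a + (b + b + c + d + e) ≡ h + (a + b + (b + c + (d + e + 0)))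
      regroupˡ = solve-∀
      regroupʳ : ∀ g b c d e o → g + (b + d + (b + e + (c + o + 0))) ≡ g + o + (b + b + c + d + e)
      regroupʳ = solve-∀

  H-simple : IsSimple H
  H-simple = edit-simple F F′ simple (proj₁ (EdgeReplacement.added-simple replacement))

  ¬Hvz : ¬ T (H v z)
  ¬Hvz vz with edit-adjacent G F F′ vz
  ... | inj₁ Gvz = v≢y (neighbour-of-z (adjacent-sym simple Gvz))
  ... | inj₂ (here (inj₁ (v≡v₂ , _))) = v≢v₂ v≡v₂
  ... | inj₂ (here (inj₂ (_ , z≡v₂))) = v₂≢z (sym z≡v₂)
  ... | inj₂ (there (here (inj₁ (v≡v₂ , _)))) = v≢v₂ v≡v₂
  ... | inj₂ (there (here (inj₂ (_ , z≡v₂)))) = v₂≢z (sym z≡v₂)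
  ... | inj₂ (there (there (here (inj₁ (v≡u , _))))) = v≢u v≡u
  ... | inj₂ (there (there (here (inj₂ (v≡z , _))))) = v≢z v≡z

  Hvq : T (H v q)
  Hvq = edit-retains G F F′ vq vq∉F
    where
    vq∉F : ¬ (v , q) ∈ₑ F
    vq∉F (here (inj₁ (_ , q≡v₂))) = v₂≢q (sym q≡v₂)
    vq∉F (here (inj₂ (v≡v₂ , _))) = v≢v₂ v≡v₂
    vq∉F (there (here (inj₁ (v≡v₂ , _)))) = v≢v₂ v≡v₂
    vq∉F (there (here (inj₂ (v≡u , _)))) = v≢u v≡u
    vq∉F (there (there (here (inj₁ (_ , q≡w2))))) = q≢w2 q≡w2
    vq∉F (there (there (here (inj₂ (_ , q≡w1))))) = q≢w1 q≡w1

  H-neighbour-of-z : ∀ {x} → T (H z x) → x ≡ y ⊎ x ≡ u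
  H-neighbour-of-z zx with edit-adjacent G F F′ zx
  ... | inj₁ Gzx = inj₁ (neighbour-of-z Gzx)
  ... | inj₂ (here (inj₁ (z≡v₂ , _))) = ⊥-elim (v₂≢z (sym z≡v₂))
  ... | inj₂ (here (inj₂ (z≡w1 , _))) = ⊥-elim (z≢w1 z≡w1)
  ... | inj₂ (there (here (inj₁ (z≡v₂ , _)))) = ⊥-elim (v₂≢z (sym z≡v₂))
  ... | inj₂ (there (here (inj₂ (z≡w2 , _)))) = ⊥-elim (z≢w2 z≡w2)
  ... | inj₂ (there (there (here (inj₁ (z≡u , _))))) = ⊥-elim (u≢z (sym z≡u))
  ... | inj₂ (there (there (here (inj₂ (_ , x≡u))))) = inj₂ x≡u

  M1-decreases : M1 H < M1 G
  M1-decreases = M1-arithmetic (deg H v) M1-balance 2≤deg-Hv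
    where
    open UnitShift degree-shift
    2≤deg-Hv : 2 ≤ deg H v
    2≤deg-Hv = ≤-pred (subst (3 ≤_) at-source 3≤dv)
    M1-balance : M1 H + (2 * deg H v + 1) ≡ M1 G + 3
    M1-balance = begin
      M1 H + (2 * deg H v + 1)
        ≡⟨ cong (_+ (2 * deg H v + 1)) (M1≡∑ H) ⟩
      ∑[ x < n ] (deg H x ^ 2) + (2 * deg H v + 1)
        ≡⟨ ∑-square-shift degree-shift ⟩
      ∑[ x < n ] (deg G x ^ 2) + (2 * deg G z + 1)
        ≡⟨ cong₂ (λ m d → m + (2 * d + 1)) (sym (M1≡∑ G)) deg-z ⟩
      M1 G + 3 ∎
      where open ≡-Reasoning

  M2-decreases : M2 H < M2 G
  M2-decreases = *-cancelˡ-< 2 (M2 H) (M2 G)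
    (M2-arithmetic {D = adjacentSum H degree-product}
      (deg G v) (deg G v₂) (deg G u) (deg G w1) (deg G w2) (deg G z)
      (trans (cong (_+ 2 * rowSum H v (deg G)) (2*M2≡adjacentSum H H-simple))
             (adjacentSum-shift H-simple ¬Hvz degree-shift))
      (trans (adjacentSum-edit simple replacement degree-product)
             (cong (_+ edgeSum F′ degree-product) (sym (2*M2≡adjacentSum G simple))))
      deg-v₂ deg-z
      (subst (_≤ rowSum H v (deg G)) deg-q (neighbour≤rowSum H (deg G) Hvq))
      (subst (λ d → rowSum H z (deg G) ≤ d + deg G u) deg-y
             (rowSum≤two-neighbours H (deg G) H-neighbour-of-z))
      3≤dv (2≤deg-onCycle w1-onCycle) (2≤deg-onCycle w2-onCycle))
    where
    degree-product : Fin n → Fin n → ℕ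
    degree-product a b = deg G a * deg G b

lemma2p4 : ∀ {n} (H3 : Graph n) → IsSimple H3 → Connected H3 →
    (w1 w2 v : Fin n) → T (H3 w1 w2) → EdgeOnCycle H3 w1 w2 → 3 ≤ deg H3 v →
    (s2 sl : ℕ) (P : Fin (2 + suc s2) → Fin n) (Q : Fin (2 + suc sl) → Fin n) →
    PendentPath H3 v (suc s2) P → PendentPath H3 v (suc sl) Q →
    (∀ i j → P i ≡ Q j → (i ≡ fz × j ≡ fz)) →
    let H4 = edit H3 ((v , P (fs fz)) ∷ (P (fs fz) , P (fs (fs fz))) ∷ (w1 , w2) ∷ [])
                     ((P (fs fz) , w1) ∷ (P (fs fz) , w2) ∷ (P (fs (fs fz)) , Q (fromℕ (1 + suc sl))) ∷ [])
    in (M1 H4 < M1 H3) × (M2 H4 < M2 H3)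
lemma2p4 H3 simple _ w1 w2 v w1w2 C 3≤dv s2 sl P Q pathP pathQ disjoint = M1-decreases , M2-decreases
  where open Configuration H3 simple w1 w2 v w1w2 C 3≤dv s2 sl P Q pathP pathQ disjoint
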